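{- Let $A$ be a set with decidable equality. Then for any two finite-permutation terms $p,q$ over $A$ it is decidable whether $[\![p]\!]=[\![q]\!]$, i.e. whether $[\![p]\!]\,a=[\![q]\!]\,a$ for all $a\in A$.
   Context: Finite-permutation terms over $A$ are given by the grammar $p::=\mathrm{Id}\mid \mathrm{Swap}(a,b)\mid \mathrm{Comp}(p,q)$ with $a,b\in A$. Their denotation is the bijection $[\![\cdot]\!]\colon A\to A$ with $[\![\mathrm{Id}]\!]=\mathrm{id}$, $[\![\mathrm{Swap}(a,b)]\!]=(a\ b)$ (the transposition swapping $a$ and $b$ and fixing all other elements), and $[\![\mathrm{Comp}(p,q)]\!]=[\![q]\!]\circ[\![p]\!]$. -}

module Defs where

open import Level using (Level)
open import Relation.Nullary using (yes; no)
open import Relation.Binary.Definitions using (DecidableEquality)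

data Perm {ℓ : Level} (A : Set ℓ) : Set ℓ where
  Id   : Perm A
  Swap : A → A → Perm A
  Comp : Perm A → Perm A → Perm A

transpose : {ℓ : Level} {A : Set ℓ} → DecidableEquality A → A → A → A → A
transpose _≟_ a b x with x ≟ a
... | yes _ = b
... | no _ with x ≟ b
...   | yes _ = a
...   | no _ = x

⟦_⟧ : {ℓ : Level} {A : Set ℓ} → Perm A → DecidableEquality A → A → A
⟦ Id ⟧       _≟_ x = x
⟦ Swap a b ⟧ _≟_ x = transpose _≟_ a b x
⟦ Comp p q ⟧ _≟_ x = ⟦ q ⟧ _≟_ (⟦ p ⟧ _≟_ x)

-- A term moves only the points it mentions, so two terms agree everywhere as soon as they
-- agree on the finitely many points occurring in either of them, and that is a finite check.
module Submission where

open import Defs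
open import Level using (Level)
open import Data.List using (List; []; _∷_; _++_)
open import Data.List.Membership.Propositional using (_∉_)
open import Data.List.Membership.Propositional.Properties using (∈-++⁺ˡ; ∈-++⁺ʳ)
open import Data.List.Relation.Unary.All as All using (All; all?)
open import Data.List.Relation.Unary.Any using (here; there)
open import Relation.Nullary using (Dec; yes; no)
open import Relation.Nullary.Decidable using (map′)
open import Relation.Binary.Definitions using (DecidableEquality)
open import Relation.Binary.PropositionalEquality using (_≡_; _≢_; refl; trans; sym; cong; module ≡-Reasoning)
open import Data.Empty using (⊥-elim)

support : {ℓ : Level} {A : Set ℓ} → Perm A → List A
support Id         = []
support (Swap a b) = a ∷ b ∷ []
support (Comp p q) = support p ++ support q

transpose-fixes : {ℓ : Level} {A : Set ℓ} (_≟_ : DecidableEquality A) (a b x : A) →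
  x ≢ a → x ≢ b → transpose _≟_ a b x ≡ x
transpose-fixes _≟_ a b x x≢a x≢b with x ≟ a
... | yes x≡a = ⊥-elim (x≢a x≡a)
... | no _ with x ≟ b
...   | yes x≡b = ⊥-elim (x≢b x≡b)
...   | no _    = refl

⟦⟧-fixes-∉-support : {ℓ : Level} {A : Set ℓ} (_≟_ : DecidableEquality A) (p : Perm A) {x : A} →
  x ∉ support p → ⟦ p ⟧ _≟_ x ≡ x
⟦⟧-fixes-∉-support _≟_ Id         _   = refl
⟦⟧-fixes-∉-support _≟_ (Swap a b) x∉ =
  transpose-fixes _≟_ a b _ (λ x≡a → x∉ (here x≡a)) (λ x≡b → x∉ (there (here x≡b)))
⟦⟧-fixes-∉-support _≟_ (Comp p q) {x} x∉ = begin
  ⟦ q ⟧ _≟_ (⟦ p ⟧ _≟_ x)  ≡⟨ cong (⟦ q ⟧ _≟_) (⟦⟧-fixes-∉-support _≟_ p (λ x∈ → x∉ (∈-++⁺ˡ x∈))) ⟩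
  ⟦ q ⟧ _≟_ x              ≡⟨ ⟦⟧-fixes-∉-support _≟_ q (λ x∈ → x∉ (∈-++⁺ʳ (support p) x∈)) ⟩
  x                        ∎
  where open ≡-Reasoning

module _ {a b : Level} {A : Set a} {B : Set b}
         (_≟ᴬ_ : DecidableEquality A) (_≟ᴮ_ : DecidableEquality B) where

  open import Data.List.Membership.DecPropositional _≟ᴬ_ using (_∈?_)

  ≗?-agreeingOutside : (xs : List A) (f g : A → B) →
    (∀ {x} → x ∉ xs → f x ≡ g x) → Dec (∀ x → f x ≡ g x)
  ≗?-agreeingOutside xs f g agree =
    map′ extend (λ f≗g → All.tabulate (λ {x} _ → f≗g x)) (all? (λ x → f x ≟ᴮ g x) xs)
    where
    extend : All (λ x → f x ≡ g x) xs → ∀ x → f x ≡ g x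
    extend onXs x with x ∈? xs
    ... | yes x∈ = All.lookup onXs x∈
    ... | no x∉  = agree x∉

mainTheorem5 : {ℓ : Level} {A : Set ℓ} (_≟_ : DecidableEquality A) (p q : Perm A) →
    Dec ((a : A) → ⟦ p ⟧ _≟_ a ≡ ⟦ q ⟧ _≟_ a)
mainTheorem5 _≟_ p q =
  ≗?-agreeingOutside _≟_ _≟_ (support p ++ support q) (⟦ p ⟧ _≟_) (⟦ q ⟧ _≟_) bothFixed
  where
  bothFixed : ∀ {x} → x ∉ support p ++ support q → ⟦ p ⟧ _≟_ x ≡ ⟦ q ⟧ _≟_ x
  bothFixed x∉ = trans (⟦⟧-fixes-∉-support _≟_ p (λ x∈ → x∉ (∈-++⁺ˡ x∈)))
                       (sym (⟦⟧-fixes-∉-support _≟_ q (λ x∈ → x∉ (∈-++⁺ʳ (support p) x∈))))
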